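{- Let $p\in\{0,1\}^m$ and let $P(\lambda)=\det(\lambda I-T_p)$ be the characteristic polynomial of $p$. Then $P(\lambda)=\lambda^m+c_{m-1}\lambda^{m-1}+\cdots+c_1\lambda+c_0$ where, for each $1\le k\le m$, $c_{m-k}=(-1)^{wt(p[1..k])}$ if $k$ is a period of $p$, and $c_{m-k}=0$ otherwise.
   Context: Binary alphabet $\{0,1\}$; strings indexed from 1, $p[i..j]$ denotes a substring, $wt(s)$ is the number of 1's in $s$. $p$ is $k$-periodic ($1\le k\le m$) if $p[i]=p[i+k]$ for all $1\le i\le m-k$. The KMP automaton of $p$ has states $q_1,\dots,q_{m+1}$, initial state $q_1$, and transition function $\delta$: $\delta(q_{m+1},c)=q_{m+1}$; $\delta(q_m,p[m])=q_{m+1}$; otherwise, for $1\le i\le m$, $\delta(q_i,c)=q_{j}$ where $j-1$ is the largest length of a suffix of $p[1..i-1]c$ that is a prefix of $p$. (Thus after reading a string $s$ the automaton is in $q_{m+1}$ iff $p$ occurs in $s$, and otherwise in $q_i$ with $i-1$ the length of the longest suffix of $s$ that is a prefix of $p$.) The transition matrix $T_p$ is the $m\times m$ integer matrix whose $(j,i)$ entry ($1\le i,j\le m$) is $\sum_{c\in\{0,1\}:\ \delta(q_i,c)=q_j}(-1)^c$. The characteristic polynomial of $p$ is $\det(\lambda I-T_p)$. -}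

module Defs where

open import Data.Bool using (Bool; true; false; if_then_else_; _∧_)
open import Data.Nat using (ℕ; zero; suc; _≡ᵇ_)
open import Data.Integer using (ℤ; +_; -_; -1ℤ; 0ℤ; 1ℤ) renaming (_+_ to _+ℤ_; _*_ to _*ℤ_; _^_ to _^ℤ_)
open import Data.List using (List; []; _∷_; _++_; length; take; map)
open import Data.Vec using (Vec; toList; lookup)
open import Data.Fin using (Fin; toℕ; punchIn)
import Data.Fin as F
open import Relation.Binary.PropositionalEquality using (_≡_)

_==ᵇ_ : Bool → Bool → Bool
true  ==ᵇ b = b
false ==ᵇ true  = false
false ==ᵇ false = true

isPrefixOf : List Bool → List Bool → Bool
isPrefixOf []       _        = true
isPrefixOf (_ ∷ _)  []       = false
isPrefixOf (x ∷ xs) (y ∷ ys) = (x ==ᵇ y) ∧ isPrefixOf xs ys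

longestSP : List Bool → List Bool → ℕ
longestSP p []       = 0
longestSP p (x ∷ xs) = if isPrefixOf (x ∷ xs) p then length (x ∷ xs) else longestSP p xs

wt : List Bool → ℕ
wt []          = 0
wt (true ∷ s)  = suc (wt s)
wt (false ∷ s) = wt s

Periodic : {m : ℕ} → Vec Bool m → ℕ → Set
Periodic {m} p k = (i j : Fin m) → toℕ j ≡ toℕ i Data.Nat.+ k → lookup p i ≡ lookup p j

signBit : Bool → ℤ
signBit true  = -1ℤ
signBit false = 1ℤ

-- State q_i (1 ≤ i ≤ m+1) is represented by i-1.
-- kmpδ p s c = nothing  means the transition goes to q_{m+1} (accepting);
-- for 1 ≤ i ≤ m (s = i-1 < m), and c, δ(q_i,c) = q_{m+1} iff i = m and c = p[m];
-- otherwise δ(q_i,c) = q_j with j-1 = longestSP p (p[1..i-1] c).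

data Target : Set where
  accept : Target
  state  : ℕ → Target

kmpδ : {m : ℕ} → Vec Bool m → (s : Fin m) → Bool → Target
kmpδ {m} p s c =
  if (suc (toℕ s) ≡ᵇ m) ∧ (c ==ᵇ lookup p s)
  then accept
  else state (longestSP (toList p) (take (toℕ s) (toList p) ++ (c ∷ [])))

hits : Target → ℕ → ℤ
hits accept    j = 0ℤ
hits (state t) j = if t ≡ᵇ j then 1ℤ else 0ℤ

-- Transition matrix: (T_p) j i = Σ_{c : δ(q_i,c) = q_j} (-1)^c   (0-based indices)
transMatrix : {m : ℕ} → Vec Bool m → Fin m → Fin m → ℤ
transMatrix p j i =
  (signBit false *ℤ hits (kmpδ p i false) (toℕ j)) +ℤ
  (signBit true  *ℤ hits (kmpδ p i true)  (toℕ j))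

-- Polynomials over ℤ as coefficient lists (constant term first).

Poly : Set
Poly = List ℤ

_+P_ : Poly → Poly → Poly
[]      +P q       = q
(a ∷ p) +P []      = a ∷ p
(a ∷ p) +P (b ∷ q) = (a +ℤ b) ∷ (p +P q)

negP : Poly → Poly
negP = map -_

scaleP : ℤ → Poly → Poly
scaleP a = map (a *ℤ_)

_*P_ : Poly → Poly → Poly
[]      *P q = []
(a ∷ p) *P q = scaleP a q +P (0ℤ ∷ (p *P q))

constP : ℤ → Poly
constP a = a ∷ []

X : Poly
X = 0ℤ ∷ 1ℤ ∷ []

coeff : Poly → ℕ → ℤ
coeff []      n       = 0ℤ
coeff (a ∷ p) zero    = a
coeff (a ∷ p) (suc n) = coeff p n

sumP : (n : ℕ) → (Fin n → Poly) → Poly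
sumP zero    f = []
sumP (suc n) f = f F.zero +P sumP n (λ i → f (F.suc i))

det : (n : ℕ) → (Fin n → Fin n → Poly) → Poly
det zero    M = constP 1ℤ
det (suc n) M =
  sumP (suc n) λ j →
    scaleP (-1ℤ ^ℤ toℕ j)
      (M F.zero j *P det n (λ r c → M (F.suc r) (punchIn j c)))

δFin : {m : ℕ} → Fin m → Fin m → Bool
δFin i j = toℕ i ≡ᵇ toℕ j

charPoly : {m : ℕ} → Vec Bool m → Poly
charPoly {m} p =
  det m λ j i → (if δFin j i then X else []) +P negP (constP (transMatrix p j i))

-- The transition matrix T_p is upper Hessenberg: from state q_{k+1} the bit p[k+1]
-- leads to q_{k+2} and the other bit falls back to the failure state q_{f(k)+1} with
-- f(k) ≤ k. Expanding along the last column, the leading principal minors D_k of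
-- λI − T_p therefore satisfy D_{k+1} = λ D_k − ε_k D_{f(k)}, where ε_k is the product
-- of the signs on the cycle q_{f(k)+1} → q_{k+1} → q_{f(k)+1}. The polynomials
-- B_k = Σ_n (−1)^{wt p[1..k−n]} λ^n, summed over the lengths n of the borders of p[1..k]
-- (suffixes that are prefixes of p), satisfy the same recursion: a border of p[1..k+1]
-- is a border of p[1..k] extended by the matching bit, while the borders of p[1..f(k)]
-- are those extended by the mismatching bit. Hence D_m = B_m, and p has a border of
-- length m − k exactly when it is k-periodic.
module Submission where

open import Defs
open import Data.Nat using (ℕ; zero; suc; _∸_; _≤_; _<_; z≤n; s≤s; _≡ᵇ_)
import Data.Nat as ℕ
import Data.Nat.Properties as ℕ
open import Data.Nat.Induction using (<-rec)
open import Data.Integer using (ℤ; 0ℤ; 1ℤ; -1ℤ; _+_; _*_; -_; _-_) renaming (_^_ to _^ℤ_)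
import Data.Integer.Properties as ℤ
open import Data.Integer.Tactic.RingSolver using (solve-∀)
open import Data.Bool using (Bool; true; false; if_then_else_; _∧_; not)
open import Data.Bool.Properties using (¬-not)
open import Data.Fin using (Fin; toℕ; fromℕ<; punchIn; punchOut; _≟_) renaming (zero to fzero; suc to fsuc)
open import Data.Fin.Properties using (punchIn-punchOut; punchInᵢ≢i; toℕ-injective; toℕ-fromℕ<; toℕ<n)
open import Data.List using (List; []; _∷_; _++_; length; take; drop)
import Data.List.Properties as List
open import Data.Vec using (Vec; toList; lookup)
import Data.Vec as Vec
import Data.Vec.Properties as Vec
open import Data.Vec.Functional using (removeAt)
open import Data.Empty using (⊥-elim)
open import Data.Product using (_×_; _,_)
open import Data.Sum using (_⊎_; inj₁; inj₂)
open import Function using (_∘_; _∘′_)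
open import Relation.Nullary using (¬_; yes; no)
open import Relation.Nullary.Decidable using (dec-true; dec-false)
open import Relation.Binary.PropositionalEquality
open import Algebra.Properties.Monoid.Sum ℤ.+-0-monoid using (sum; sum-syntax; sum-cong-≗; sum-replicate-zero)
open import Algebra.Properties.CommutativeMonoid.Sum ℤ.+-0-commutativeMonoid using (∑-distrib-+; sum-remove)

sum-zero : ∀ {n} (f : Fin n → ℤ) → (∀ j → f j ≡ 0ℤ) → sum f ≡ 0ℤ
sum-zero {n} f f≗0 = trans (sum-cong-≗ f≗0) (sum-replicate-zero n)

sum-neg : ∀ {n} (f : Fin n → ℤ) → sum (λ j → - f j) ≡ - sum f
sum-neg {zero}  f = refl
sum-neg {suc n} f = trans (cong (- f fzero +_) (sum-neg (f ∘ fsuc))) (sym (ℤ.neg-distrib-+ (f fzero) _))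

sum-distrib-sub : ∀ {n} (f g : Fin n → ℤ) → sum (λ j → f j - g j) ≡ sum f - sum g
sum-distrib-sub f g = trans (∑-distrib-+ f (λ j → - g j)) (cong (sum f +_) (sum-neg g))

sum-delta : ∀ {n} (f : ℕ → ℤ) i → i < n → (∀ (j : Fin n) → toℕ j ≢ i → f (toℕ j) ≡ 0ℤ) →
  ∑[ j < n ] f (toℕ j) ≡ f i
sum-delta {suc n} f i i<n others≡0 = begin
    ∑[ j < suc n ] f (toℕ j)
  ≡⟨ sum-remove {i = ı} (f ∘ toℕ) ⟩
    f (toℕ ı) + sum (removeAt (f ∘ toℕ) ı)
  ≡⟨ cong₂ _+_ (cong f (toℕ-fromℕ< i<n)) (sum-zero _ λ j → others≡0 (punchIn ı j) (punchIn≢ j)) ⟩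
    f i + 0ℤ
  ≡⟨ ℤ.+-identityʳ (f i) ⟩
    f i
  ∎
  where
  open ≡-Reasoning
  ı = fromℕ< i<n
  punchIn≢ : ∀ j → toℕ (punchIn ı j) ≢ i
  punchIn≢ j eq = punchInᵢ≢i ı j (toℕ-injective (trans eq (sym (toℕ-fromℕ< i<n))))

Coeffs : Set
Coeffs = ℕ → ℤ

_≈_ : Poly → Poly → Set
p ≈ q = coeff p ≗ coeff q

infix 4 _≈_

coeff-+P : ∀ p q n → coeff (p +P q) n ≡ coeff p n + coeff q n
coeff-+P []      q       n       = sym (ℤ.+-identityˡ (coeff q n))
coeff-+P (a ∷ p) []      n       = sym (ℤ.+-identityʳ (coeff (a ∷ p) n))
coeff-+P (a ∷ p) (b ∷ q) zero    = refl
coeff-+P (a ∷ p) (b ∷ q) (suc n) = coeff-+P p q n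

coeff-scaleP : ∀ a p n → coeff (scaleP a p) n ≡ a * coeff p n
coeff-scaleP a []      n       = sym (ℤ.*-zeroʳ a)
coeff-scaleP a (b ∷ p) zero    = refl
coeff-scaleP a (b ∷ p) (suc n) = coeff-scaleP a p n

coeff-sumP : ∀ n (f : Fin n → Poly) k → coeff (sumP n f) k ≡ sum (λ j → coeff (f j) k)
coeff-sumP zero    f k = refl
coeff-sumP (suc n) f k =
  trans (coeff-+P (f fzero) _ k) (cong (coeff (f fzero) k +_) (coeff-sumP n (f ∘ fsuc) k))

_⊛_ : Coeffs → Coeffs → Coeffs
(f ⊛ g) zero    = f 0 * g 0
(f ⊛ g) (suc n) = f 0 * g (suc n) + ((f ∘ suc) ⊛ g) n

infixl 7 _⊛_

⊛-zeroˡ : ∀ f g → f ≗ (λ _ → 0ℤ) → f ⊛ g ≗ (λ _ → 0ℤ)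
⊛-zeroˡ f g f≗0 zero    rewrite f≗0 0 = refl
⊛-zeroˡ f g f≗0 (suc n) rewrite f≗0 0 | ⊛-zeroˡ (f ∘ suc) g (f≗0 ∘ suc) n = refl

⊛-zeroʳ : ∀ f g → g ≗ (λ _ → 0ℤ) → f ⊛ g ≗ (λ _ → 0ℤ)
⊛-zeroʳ f g g≗0 zero    rewrite g≗0 0 = ℤ.*-zeroʳ (f 0)
⊛-zeroʳ f g g≗0 (suc n) rewrite g≗0 (suc n) | ⊛-zeroʳ (f ∘ suc) g g≗0 n =
  trans (ℤ.+-identityʳ _) (ℤ.*-zeroʳ (f 0))

⊛-cong : ∀ {f f′ g g′} → f ≗ f′ → g ≗ g′ → f ⊛ g ≗ f′ ⊛ g′
⊛-cong f≗ g≗ zero    = cong₂ _*_ (f≗ 0) (g≗ 0)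
⊛-cong f≗ g≗ (suc n) = cong₂ _+_ (cong₂ _*_ (f≗ 0) (g≗ (suc n))) (⊛-cong (f≗ ∘ suc) g≗ n)

coeff-*P : ∀ p q → coeff (p *P q) ≗ coeff p ⊛ coeff q
coeff-*P []      q n       = sym (⊛-zeroˡ (coeff []) (coeff q) (λ _ → refl) n)
coeff-*P (a ∷ p) q zero    =
  trans (coeff-+P (scaleP a q) _ 0) (trans (ℤ.+-identityʳ _) (coeff-scaleP a q 0))
coeff-*P (a ∷ p) q (suc n) =
  trans (coeff-+P (scaleP a q) _ (suc n)) (cong₂ _+_ (coeff-scaleP a q (suc n)) (coeff-*P p q n))

mulX : Coeffs → Coeffs
mulX F zero    = 0ℤ
mulX F (suc n) = F n

mulX-cong : ∀ {F G} → F ≗ G → mulX F ≗ mulX G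
mulX-cong F≗G zero    = refl
mulX-cong F≗G (suc n) = F≗G n

linear : ℤ → ℤ → Poly
linear a b = a ∷ b ∷ []

linearMul : ℤ → ℤ → Coeffs → Coeffs
linearMul a b F zero    = a * F 0
linearMul a b F (suc n) = a * F (suc n) + b * F n

⊛-linear : ∀ a b g → coeff (linear a b) ⊛ g ≗ linearMul a b g
⊛-linear a b g zero          = refl
⊛-linear a b g (suc zero)    = refl
⊛-linear a b g (suc (suc n)) = cong (λ t → a * g (suc (suc n)) + t)
  (trans (cong (b * g (suc n) +_) (⊛-zeroˡ (λ _ → 0ℤ) g (λ _ → refl) n)) (ℤ.+-identityʳ (b * g (suc n))))

linearMul-expand : ∀ a b F n → linearMul a b F n ≡ a * F n + b * mulX F n
linearMul-expand a b F zero    = sym (trans (cong (a * F 0 +_) (ℤ.*-zeroʳ b)) (ℤ.+-identityʳ _))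
linearMul-expand a b F (suc n) = refl

linearMul-cong : ∀ a b {F G} → F ≗ G → linearMul a b F ≗ linearMul a b G
linearMul-cong a b F≗G zero    = cong (a *_) (F≗G 0)
linearMul-cong a b F≗G (suc n) = cong₂ (λ x y → a * x + b * y) (F≗G (suc n)) (F≗G n)

linearMul-constant : ∀ a F → linearMul a 0ℤ F ≗ λ n → a * F n
linearMul-constant a F zero    = refl
linearMul-constant a F (suc n) = trans (cong (a * F (suc n) +_) (ℤ.*-zeroˡ (F n))) (ℤ.+-identityʳ _)

linearMul-comm : ∀ a b a′ b′ F →
  linearMul a b (linearMul a′ b′ F) ≗ linearMul a′ b′ (linearMul a b F)
linearMul-comm a b a′ b′ F zero          = swap₀ a a′ (F 0)
  where swap₀ : ∀ a a′ x → a * (a′ * x) ≡ a′ * (a * x)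
        swap₀ = solve-∀
linearMul-comm a b a′ b′ F (suc zero)    = swap₁ a b a′ b′ (F 1) (F 0)
  where swap₁ : ∀ a b a′ b′ x y →
          a * (a′ * x + b′ * y) + b * (a′ * y) ≡ a′ * (a * x + b * y) + b′ * (a * y)
        swap₁ = solve-∀
linearMul-comm a b a′ b′ F (suc (suc n)) = swap₂ a b a′ b′ (F (suc (suc n))) (F (suc n)) (F n)
  where swap₂ : ∀ a b a′ b′ x y z →
          a * (a′ * x + b′ * y) + b * (a′ * y + b′ * z) ≡ a′ * (a * x + b * y) + b′ * (a * y + b * z)
        swap₂ = solve-∀

linearMul-scale : ∀ a b c F → linearMul a b (λ k → c * F k) ≗ λ k → c * linearMul a b F k
linearMul-scale a b c F zero    = swap a c (F 0)
  where swap : ∀ a c x → a * (c * x) ≡ c * (a * x)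
        swap = solve-∀
linearMul-scale a b c F (suc n) = factor a b c (F (suc n)) (F n)
  where factor : ∀ a b c x y → a * (c * x) + b * (c * y) ≡ c * (a * x + b * y)
        factor = solve-∀

linearMul-+ : ∀ a b F G → linearMul a b (λ k → F k + G k) ≗ λ k → linearMul a b F k + linearMul a b G k
linearMul-+ a b F G zero    = ℤ.*-distribˡ-+ a (F 0) (G 0)
linearMul-+ a b F G (suc n) = distrib a b (F (suc n)) (G (suc n)) (F n) (G n)
  where distrib : ∀ a b x y u v → a * (x + y) + b * (u + v) ≡ (a * x + b * u) + (a * y + b * v)
        distrib = solve-∀

linearMul-sub : ∀ a b F G → linearMul a b (λ k → F k - G k) ≗ λ k → linearMul a b F k - linearMul a b G k
linearMul-sub a b F G zero    = distrib a (F 0) (G 0)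
  where distrib : ∀ a x y → a * (x - y) ≡ a * x - a * y
        distrib = solve-∀
linearMul-sub a b F G (suc n) = distrib a b (F (suc n)) (G (suc n)) (F n) (G n)
  where distrib : ∀ a b x y u v → a * (x - y) + b * (u - v) ≡ (a * x + b * u) - (a * y + b * v)
        distrib = solve-∀

linearMul-sum : ∀ a b {n} (F : Fin n → Coeffs) →
  linearMul a b (λ k → sum (λ j → F j k)) ≗ λ k → sum (λ j → linearMul a b (F j) k)
linearMul-sum a b {zero}  F zero    = ℤ.*-zeroʳ a
linearMul-sum a b {zero}  F (suc k) = cong₂ _+_ (ℤ.*-zeroʳ a) (ℤ.*-zeroʳ b)
linearMul-sum a b {suc n} F k       =
  trans (linearMul-+ a b (F fzero) (λ k → sum (λ j → F (fsuc j) k)) k)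
        (cong (linearMul a b (F fzero) k +_) (linearMul-sum a b (F ∘ fsuc) k))

minor : ∀ {n} {A : Set} → (Fin (suc n) → Fin (suc n) → A) → Fin (suc n) → Fin n → Fin n → A
minor M j r c = M (fsuc r) (punchIn j c)

coeff-det-laplace : ∀ n M k → coeff (det (suc n) M) k
  ≡ sum (λ j → (-1ℤ ^ℤ toℕ j) * (coeff (M fzero j) ⊛ coeff (det n (minor M j))) k)
coeff-det-laplace n M k = trans (coeff-sumP (suc n) term k) (sum-cong-≗ λ j →
  trans (coeff-scaleP (-1ℤ ^ℤ toℕ j) (M fzero j *P det n (minor M j)) k)
        (cong ((-1ℤ ^ℤ toℕ j) *_) (coeff-*P (M fzero j) (det n (minor M j)) k)))
  where
  term : Fin (suc n) → Poly
  term j = scaleP (-1ℤ ^ℤ toℕ j) (M fzero j *P det n (minor M j))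

det-cong : ∀ n {M M′} → (∀ r c → M r c ≈ M′ r c) → det n M ≈ det n M′
det-cong zero    M≈ k = refl
det-cong (suc n) {M} {M′} M≈ k = trans (coeff-det-laplace n M k) (trans
  (sum-cong-≗ λ j → cong ((-1ℤ ^ℤ toℕ j) *_)
    (⊛-cong (M≈ fzero j) (det-cong n {minor M j} {minor M′ j} (λ r c → M≈ (fsuc r) (punchIn j c))) k))
  (sym (coeff-det-laplace n M′ k)))

det-zero-column : ∀ n M (q : Fin n) → (∀ r → M r q ≈ []) → det n M ≈ []
det-zero-column (suc n) M q col≈0 k = trans (coeff-det-laplace n M k) (sum-zero _ term≡0)
  where
  term≡0 : ∀ j → (-1ℤ ^ℤ toℕ j) * (coeff (M fzero j) ⊛ coeff (det n (minor M j))) k ≡ 0ℤ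
  term≡0 j with j ≟ q
  ... | yes refl = trans (cong ((-1ℤ ^ℤ toℕ j) *_) (⊛-zeroˡ (coeff (M fzero j)) _ (col≈0 fzero) k))
                         (ℤ.*-zeroʳ (-1ℤ ^ℤ toℕ j))
  ... | no j≢q = trans (cong ((-1ℤ ^ℤ toℕ j) *_) (⊛-zeroʳ (coeff (M fzero j)) _ minor≈0 k))
                       (ℤ.*-zeroʳ (-1ℤ ^ℤ toℕ j))
    where
    minor≈0 : det n (minor M j) ≈ []
    minor≈0 = det-zero-column n (minor M j) (punchOut j≢q) λ r →
      subst (λ c → M (fsuc r) c ≈ []) (sym (punchIn-punchOut j≢q)) (col≈0 (fsuc r))

det-first-column : ∀ n M → (∀ r → M (fsuc r) fzero ≈ []) →
  coeff (det (suc n) M) ≗ coeff (M fzero fzero) ⊛ coeff (det n (minor M fzero))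
det-first-column zero    M col≈0 k =
  trans (coeff-det-laplace 0 M k) (trans (ℤ.+-identityʳ _) (ℤ.*-identityˡ _))
det-first-column (suc n) M col≈0 k = trans (coeff-det-laplace (suc n) M k)
  (trans (cong₂ _+_ (ℤ.*-identityˡ first) (sum-zero _ later≡0)) (ℤ.+-identityʳ first))
  where
  first = (coeff (M fzero fzero) ⊛ coeff (det (suc n) (minor M fzero))) k
  later≡0 : ∀ j → (-1ℤ ^ℤ toℕ (fsuc j)) *
    (coeff (M fzero (fsuc j)) ⊛ coeff (det (suc n) (minor M (fsuc j)))) k ≡ 0ℤ
  later≡0 j = trans (cong (sign *_) (⊛-zeroʳ (coeff (M fzero (fsuc j))) _ minor≈0 k)) (ℤ.*-zeroʳ sign)
    where
    sign = -1ℤ ^ℤ toℕ (fsuc j)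
    minor≈0 : det (suc n) (minor M (fsuc j)) ≈ []
    minor≈0 = det-zero-column (suc n) (minor M (fsuc j)) fzero col≈0

ℤMatrix : Set
ℤMatrix = ℕ → ℕ → ℤ

-- The leading n × n block of A + λB, for matrices A, B indexed by ℕ from 0.
pencil : (n : ℕ) → ℤMatrix → ℤMatrix → Fin n → Fin n → Poly
pencil n A B r c = linear (A (toℕ r) (toℕ c)) (B (toℕ r) (toℕ c))

pencilDet : ℕ → ℤMatrix → ℤMatrix → Coeffs
pencilDet n A B = coeff (det n (pencil n A B))

delete₀₀ : ℤMatrix → ℤMatrix
delete₀₀ A r c = A (suc r) (suc c)

delete₁₀ : ℤMatrix → ℤMatrix
delete₁₀ A zero    c = A zero (suc c)
delete₁₀ A (suc r) c = A (suc (suc r)) (suc c)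

pencilDet-laplace : ∀ n A B k → pencilDet (suc n) A B k ≡
  sum (λ j → (-1ℤ ^ℤ toℕ j) *
    linearMul (A 0 (toℕ j)) (B 0 (toℕ j)) (coeff (det n (minor (pencil (suc n) A B) j))) k)
pencilDet-laplace n A B k = trans (coeff-det-laplace n (pencil (suc n) A B) k) (sum-cong-≗ λ j →
  cong ((-1ℤ ^ℤ toℕ j) *_)
    (⊛-linear (A 0 (toℕ j)) (B 0 (toℕ j)) (coeff (det n (minor (pencil (suc n) A B) j))) k))

pencilDet-one : ∀ A B → pencilDet 1 A B ≗ linearMul (A 0 0) (B 0 0) (pencilDet 0 A B)
pencilDet-one A B k = trans (pencilDet-laplace 0 A B k)
  (trans (ℤ.+-identityʳ _) (ℤ.*-identityˡ (linearMul (A 0 0) (B 0 0) (pencilDet 0 A B) k)))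

pencilDet-firstColumn : ∀ n A B → (∀ r → A (suc (suc r)) 0 ≡ 0ℤ) → (∀ r → B (suc (suc r)) 0 ≡ 0ℤ) →
  pencilDet (suc (suc n)) A B ≗ λ k →
    linearMul (A 0 0) (B 0 0) (pencilDet (suc n) (delete₀₀ A) (delete₀₀ B)) k
    - linearMul (A 1 0) (B 1 0) (pencilDet (suc n) (delete₁₀ A) (delete₁₀ B)) k
pencilDet-firstColumn n A B A-col B-col k =
  trans (pencilDet-laplace (suc n) A B k) (cong₂ _+_ (ℤ.*-identityˡ first) later)
  where
  open ≡-Reasoning
  first = linearMul (A 0 0) (B 0 0) (pencilDet (suc n) (delete₀₀ A) (delete₀₀ B)) k
  M = pencil (suc (suc n)) A B
  R = pencil (suc n) (delete₁₀ A) (delete₁₀ B)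
  lin₁₀ = linearMul (A 1 0) (B 1 0)
  a₀ b₀ : Fin (suc n) → ℤ
  a₀ j = A 0 (suc (toℕ j))
  b₀ j = B 0 (suc (toℕ j))
  lin₀ : Fin (suc n) → Coeffs → Coeffs
  lin₀ j = linearMul (a₀ j) (b₀ j)
  D : Fin (suc n) → Coeffs
  D j = coeff (det n (minor R j))
  minor-det : ∀ j → coeff (det (suc n) (minor M (fsuc j))) ≗ lin₁₀ (D j)
  minor-det j k = trans (det-first-column n (minor M (fsuc j)) col≈0 k) (⊛-linear (A 1 0) (B 1 0) (D j) k)
    where
    col≈0 : ∀ r → minor M (fsuc j) (fsuc r) fzero ≈ []
    col≈0 r zero          = A-col (toℕ r)
    col≈0 r (suc zero)    = B-col (toℕ r)
    col≈0 r (suc (suc i)) = refl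
  later : sum (λ j → (-1ℤ ^ℤ toℕ (fsuc j)) * lin₀ j (coeff (det (suc n) (minor M (fsuc j)))) k)
        ≡ - lin₁₀ (pencilDet (suc n) (delete₁₀ A) (delete₁₀ B)) k
  later = begin
      sum (λ j → (-1ℤ ^ℤ toℕ (fsuc j)) * lin₀ j (coeff (det (suc n) (minor M (fsuc j)))) k)
    ≡⟨ sum-cong-≗ (λ j → cong₂ (λ s x → s * x) (ℤ.-1*i≡-i (-1ℤ ^ℤ toℕ j))
         (trans (linearMul-cong (a₀ j) (b₀ j) (minor-det j) k)
                (linearMul-comm (a₀ j) (b₀ j) (A 1 0) (B 1 0) (D j) k))) ⟩
      sum (λ j → - (-1ℤ ^ℤ toℕ j) * lin₁₀ (lin₀ j (D j)) k)
    ≡⟨ sum-cong-≗ (λ j → trans (sym (ℤ.neg-distribˡ-* (-1ℤ ^ℤ toℕ j) (lin₁₀ (lin₀ j (D j)) k)))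
         (cong -_ (sym (linearMul-scale (A 1 0) (B 1 0) (-1ℤ ^ℤ toℕ j) (lin₀ j (D j)) k)))) ⟩
      sum (λ j → - lin₁₀ (λ k → (-1ℤ ^ℤ toℕ j) * lin₀ j (D j) k) k)
    ≡⟨ sum-neg (λ j → lin₁₀ (λ k → (-1ℤ ^ℤ toℕ j) * lin₀ j (D j) k) k) ⟩
      - sum (λ j → lin₁₀ (λ k → (-1ℤ ^ℤ toℕ j) * lin₀ j (D j) k) k)
    ≡⟨ cong -_ (sym (linearMul-sum _ _ (λ j k → (-1ℤ ^ℤ toℕ j) * lin₀ j (D j) k) k)) ⟩
      - lin₁₀ (λ k → sum (λ j → (-1ℤ ^ℤ toℕ j) * lin₀ j (D j) k)) k
    ≡⟨ cong -_ (linearMul-cong _ _ (λ k → sym (pencilDet-laplace n (delete₁₀ A) (delete₁₀ B) k)) k) ⟩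
      - lin₁₀ (pencilDet (suc n) (delete₁₀ A) (delete₁₀ B)) k
    ∎

subdiagonal : ℤMatrix → ℕ → ℤ
subdiagonal A t = A (suc t) t

negProdFrom : (ℕ → ℤ) → ℕ → ℕ → ℤ
negProdFrom s r zero    = 1ℤ
negProdFrom s r (suc d) = - s r * negProdFrom s (suc r) d

negProdFrom-shift : ∀ s r d → negProdFrom (s ∘ suc) r d ≡ negProdFrom s (suc r) d
negProdFrom-shift s r zero    = refl
negProdFrom-shift s r (suc d) = cong (- s (suc r) *_) (negProdFrom-shift s (suc r) d)

IsHessenberg : ℤMatrix → Set
IsHessenberg A = ∀ r c → A (suc (suc (c ℕ.+ r))) c ≡ 0ℤ

lastColumnTerm : ℤMatrix → ℤMatrix → ℕ → ℕ → Coeffs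
lastColumnTerm A B k r n =
  negProdFrom (subdiagonal A) r (k ∸ r) * linearMul (A r k) (B r k) (pencilDet r A B) n

module LastColumnTerms (k : ℕ) (A B : ℤMatrix) (A-hess : IsHessenberg A) (B-hess : IsHessenberg B)
                       (B-sub : ∀ t → subdiagonal B t ≡ 0ℤ) (n : ℕ) where

  A₀₀ B₀₀ A₁₀ B₁₀ : ℤMatrix
  A₀₀ = delete₀₀ A
  B₀₀ = delete₀₀ B
  A₁₀ = delete₁₀ A
  B₁₀ = delete₁₀ B

  lin₀₀ lin₁₀ : Coeffs → Coeffs
  lin₀₀ = linearMul (A 0 0) (B 0 0)
  lin₁₀ = linearMul (A 1 0) (B 1 0)

  T₀₀ T₁₀ : ℕ → Coeffs
  T₀₀ = lastColumnTerm A₀₀ B₀₀ k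
  T₁₀ = lastColumnTerm A₁₀ B₁₀ k

  T : ℕ → ℤ
  T r = lastColumnTerm A B (suc k) r n

  private
    L₀ : Coeffs
    L₀ = pencilDet 0 A B
    P : ℕ → ℕ → ℤ
    P = negProdFrom (subdiagonal A)

  lastColumnTerm-zero : - lin₁₀ (T₁₀ 0) n ≡ T 0
  lastColumnTerm-zero = begin
      - lin₁₀ (T₁₀ 0) n
    ≡⟨ cong (λ b → - linearMul (A 1 0) b (T₁₀ 0) n) (B-sub 0) ⟩
      - linearMul (A 1 0) 0ℤ (T₁₀ 0) n
    ≡⟨ cong -_ (linearMul-constant (A 1 0) (T₁₀ 0) n) ⟩
      - (A 1 0 * (negProdFrom (subdiagonal A ∘ suc) 0 k * F))
    ≡⟨ cong (λ q → - (A 1 0 * (q * F))) (negProdFrom-shift (subdiagonal A) 0 k) ⟩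
      - (A 1 0 * (P 1 k * F))
    ≡⟨ neg-assoc (A 1 0) (P 1 k) F ⟩
      T 0
    ∎
    where
    open ≡-Reasoning
    F = linearMul (A 0 (suc k)) (B 0 (suc k)) L₀ n
    neg-assoc : ∀ a q x → - (a * (q * x)) ≡ (- a * q) * x
    neg-assoc = solve-∀

  lastColumnTerm-one : lin₀₀ (T₀₀ 0) n ≡ T 1
  lastColumnTerm-one = begin
      lin₀₀ (T₀₀ 0) n
    ≡⟨ linearMul-scale (A 0 0) (B 0 0) (negProdFrom (subdiagonal A ∘ suc) 0 k) (lin₁ L₀) n ⟩
      negProdFrom (subdiagonal A ∘ suc) 0 k * lin₀₀ (lin₁ L₀) n
    ≡⟨ cong₂ _*_ (negProdFrom-shift (subdiagonal A) 0 k)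
         (linearMul-comm (A 0 0) (B 0 0) (A 1 (suc k)) (B 1 (suc k)) L₀ n) ⟩
      P 1 k * lin₁ (lin₀₀ L₀) n
    ≡⟨ cong (P 1 k *_) (linearMul-cong (A 1 (suc k)) (B 1 (suc k)) (λ n → sym (pencilDet-one A B n)) n) ⟩
      T 1
    ∎
    where
    open ≡-Reasoning
    lin₁ = linearMul (A 1 (suc k)) (B 1 (suc k))

  lastColumnTerm-suc₂ : ∀ r → lin₀₀ (T₀₀ (suc r)) n - lin₁₀ (T₁₀ (suc r)) n ≡ T (suc (suc r))
  lastColumnTerm-suc₂ r = begin
      lin₀₀ (T₀₀ (suc r)) n - lin₁₀ (T₁₀ (suc r)) n
    ≡⟨ cong₂ _-_ (linearMul-scale (A 0 0) (B 0 0) N (lin L₀₀) n)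
                 (linearMul-scale (A 1 0) (B 1 0) N (lin L₁₀) n) ⟩
      N * lin₀₀ (lin L₀₀) n - N * lin₁₀ (lin L₁₀) n
    ≡⟨ cong₂ (λ x y → N * x - N * y)
         (linearMul-comm (A 0 0) (B 0 0) a b L₀₀ n) (linearMul-comm (A 1 0) (B 1 0) a b L₁₀ n) ⟩
      N * lin (lin₀₀ L₀₀) n - N * lin (lin₁₀ L₁₀) n
    ≡⟨ factor N (lin (lin₀₀ L₀₀) n) (lin (lin₁₀ L₁₀) n) ⟩
      N * (lin (lin₀₀ L₀₀) n - lin (lin₁₀ L₁₀) n)
    ≡⟨ cong (N *_) (sym (linearMul-sub a b (lin₀₀ L₀₀) (lin₁₀ L₁₀) n)) ⟩
      N * lin (λ n → lin₀₀ L₀₀ n - lin₁₀ L₁₀ n) n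
    ≡⟨ cong₂ _*_ (negProdFrom-shift (subdiagonal A) (suc r) (k ∸ suc r))
         (linearMul-cong a b
           (λ n → sym (pencilDet-firstColumn r A B (λ r → A-hess r 0) (λ r → B-hess r 0) n)) n) ⟩
      T (suc (suc r))
    ∎
    where
    open ≡-Reasoning
    a = A (suc (suc r)) (suc k)
    b = B (suc (suc r)) (suc k)
    lin = linearMul a b
    N = negProdFrom (subdiagonal A ∘ suc) (suc r) (k ∸ suc r)
    L₀₀ = pencilDet (suc r) A₀₀ B₀₀
    L₁₀ = pencilDet (suc r) A₁₀ B₁₀
    factor : ∀ a x y → a * x - a * y ≡ a * (x - y)
    factor = solve-∀

pencilDet-lastColumn : ∀ k A B → IsHessenberg A → IsHessenberg B → (∀ t → subdiagonal B t ≡ 0ℤ) →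
  pencilDet (suc k) A B ≗ λ n → ∑[ r < suc k ] lastColumnTerm A B k (toℕ r) n
pencilDet-lastColumn zero A B _ _ _ n =
  trans (pencilDet-one A B n) (sym (trans (ℤ.+-identityʳ _) (ℤ.*-identityˡ _)))
pencilDet-lastColumn (suc k) A B A-hess B-hess B-sub n = begin
    pencilDet (suc (suc k)) A B n
  ≡⟨ pencilDet-firstColumn k A B (λ r → A-hess r 0) (λ r → B-hess r 0) n ⟩
    lin₀₀ (pencilDet (suc k) A₀₀ B₀₀) n - lin₁₀ (pencilDet (suc k) A₁₀ B₁₀) n
  ≡⟨ cong₂ _-_ (expand-minor (A 0 0) (B 0 0) A₀₀ B₀₀ A-hess′ B-hess′ (B-sub ∘ suc))
               (expand-minor (A 1 0) (B 1 0) A₁₀ B₁₀ A-hess′ B-hess′ (B-sub ∘ suc)) ⟩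
    (lin₀₀ (T₀₀ 0) n + S₀₀) - (lin₁₀ (T₁₀ 0) n + S₁₀)
  ≡⟨ regroup (lin₀₀ (T₀₀ 0) n) S₀₀ (lin₁₀ (T₁₀ 0) n) S₁₀ ⟩
    - lin₁₀ (T₁₀ 0) n + (lin₀₀ (T₀₀ 0) n + (S₀₀ - S₁₀))
  ≡⟨ cong₂ (λ x y → x + (y + (S₀₀ - S₁₀))) lastColumnTerm-zero lastColumnTerm-one ⟩
    T 0 + (T 1 + (S₀₀ - S₁₀))
  ≡⟨ cong (λ x → T 0 + (T 1 + x)) (trans
       (sym (sum-distrib-sub {k} (λ r → lin₀₀ (T₀₀ (suc (toℕ r))) n) (λ r → lin₁₀ (T₁₀ (suc (toℕ r))) n)))
       (sum-cong-≗ {k} (λ r → lastColumnTerm-suc₂ (toℕ r)))) ⟩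
    T 0 + (T 1 + ∑[ r < k ] T (suc (suc (toℕ r))))
  ∎
  where
  open ≡-Reasoning
  open LastColumnTerms k A B A-hess B-hess B-sub n
  S₀₀ S₁₀ : ℤ
  S₀₀ = ∑[ r < k ] lin₀₀ (T₀₀ (suc (toℕ r))) n
  S₁₀ = ∑[ r < k ] lin₁₀ (T₁₀ (suc (toℕ r))) n
  A-hess′ : IsHessenberg A₀₀
  A-hess′ r c = A-hess r (suc c)
  B-hess′ : IsHessenberg B₀₀
  B-hess′ r c = B-hess r (suc c)
  expand-minor : ∀ a b A′ B′ → IsHessenberg A′ → IsHessenberg B′ → (∀ t → subdiagonal B′ t ≡ 0ℤ) →
    linearMul a b (pencilDet (suc k) A′ B′) n
    ≡ ∑[ r < suc k ] linearMul a b (lastColumnTerm A′ B′ k (toℕ r)) n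
  expand-minor a b A′ B′ A′-hess B′-hess B′-sub =
    trans (linearMul-cong a b (pencilDet-lastColumn k A′ B′ A′-hess B′-hess B′-sub) n)
          (linearMul-sum a b {suc k} (λ r → lastColumnTerm A′ B′ k (toℕ r)) n)
  regroup : ∀ a b c d → (a + b) - (c + d) ≡ - c + (a + (b - d))
  regroup = solve-∀

signOf : List Bool → ℤ
signOf []       = 1ℤ
signOf (c ∷ xs) = signBit c * signOf xs

signOf-++ : ∀ xs ys → signOf (xs ++ ys) ≡ signOf xs * signOf ys
signOf-++ []       ys = sym (ℤ.*-identityˡ (signOf ys))
signOf-++ (c ∷ xs) ys =
  trans (cong (signBit c *_) (signOf-++ xs ys)) (sym (ℤ.*-assoc (signBit c) (signOf xs) (signOf ys)))

signBit-square : ∀ c → signBit c * signBit c ≡ 1ℤ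
signBit-square true  = refl
signBit-square false = refl

signOf-square : ∀ xs → signOf xs * signOf xs ≡ 1ℤ
signOf-square []       = refl
signOf-square (c ∷ xs) = trans (interchange (signBit c) (signOf xs))
  (cong₂ _*_ (signBit-square c) (signOf-square xs))
  where interchange : ∀ a b → (a * b) * (a * b) ≡ (a * a) * (b * b)
        interchange = solve-∀

signOf≡-1^wt : ∀ xs → signOf xs ≡ -1ℤ ^ℤ wt xs
signOf≡-1^wt []          = refl
signOf≡-1^wt (true ∷ xs)  = cong (-1ℤ *_) (signOf≡-1^wt xs)
signOf≡-1^wt (false ∷ xs) = trans (ℤ.*-identityˡ (signOf xs)) (signOf≡-1^wt xs)

signBit-flip : ∀ c → signBit c ≡ - signBit (not c)
signBit-flip true  = refl
signBit-flip false = refl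

false≢true : false ≢ true
false≢true ()

==ᵇ-refl : ∀ c → (c ==ᵇ c) ≡ true
==ᵇ-refl true  = refl
==ᵇ-refl false = refl

not-==ᵇ : ∀ c → (not c ==ᵇ c) ≡ false
not-==ᵇ true  = refl
not-==ᵇ false = refl

==ᵇ-not-either : ∀ a c →
  (a ==ᵇ c) ≡ true × (not a ==ᵇ c) ≡ false ⊎ (a ==ᵇ c) ≡ false × (not a ==ᵇ c) ≡ true
==ᵇ-not-either true  true  = inj₁ (refl , refl)
==ᵇ-not-either true  false = inj₂ (refl , refl)
==ᵇ-not-either false true  = inj₂ (refl , refl)
==ᵇ-not-either false false = inj₁ (refl , refl)

-- The bit at a 0-based position; positions out of range read as false.
at : List Bool → ℕ → Bool
at []       _       = false
at (x ∷ xs) zero    = x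
at (x ∷ xs) (suc n) = at xs n

length-take-≤ : ∀ k (xs : List Bool) → length (take k xs) ≤ k
length-take-≤ k xs = ℕ.≤-trans (ℕ.≤-reflexive (List.length-take k xs)) (ℕ.m⊓n≤m k (length xs))

length-take-of-≤ : ∀ {k} (xs : List Bool) → k ≤ length xs → length (take k xs) ≡ k
length-take-of-≤ {k} xs k≤ = trans (List.length-take k xs) (ℕ.m≤n⇒m⊓n≡m k≤)

length-snoc : ∀ (xs : List Bool) c → length (xs ++ c ∷ []) ≡ suc (length xs)
length-snoc xs c = trans (List.length-++-sucʳ xs c []) (cong (suc ∘′ length) (List.++-identityʳ xs))

take-take-≤ : ∀ {i j} (xs : List Bool) → i ≤ j → take i (take j xs) ≡ take i xs
take-take-≤ {i} {j} xs i≤j = trans (List.take-take i j xs) (cong (λ n → take n xs) (ℕ.m≤n⇒m⊓n≡m i≤j))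

take-++-≤ : ∀ {i} (xs ys : List Bool) → i ≤ length xs → take i (xs ++ ys) ≡ take i xs
take-++-≤ {zero}  xs       ys _         = refl
take-++-≤ {suc i} (x ∷ xs) ys (s≤s i≤) = cong (x ∷_) (take-++-≤ xs ys i≤)

take-split : ∀ {f k} (xs : List Bool) → f ≤ k → take k xs ≡ take f xs ++ take (k ∸ f) (drop f xs)
take-split {f} {k} xs f≤k = begin
    take k xs
  ≡⟨ List.take++drop≡id f (take k xs) ⟨
    take f (take k xs) ++ drop f (take k xs)
  ≡⟨ cong₂ _++_ (take-take-≤ xs f≤k) (sym (trans (List.take-drop (k ∸ f) f xs)
       (cong (λ n → drop f (take n xs)) (ℕ.m+[n∸m]≡n f≤k)))) ⟩
    take f xs ++ take (k ∸ f) (drop f xs)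
  ∎
  where open ≡-Reasoning

take-snoc : ∀ {t} (xs : List Bool) → t < length xs → take t xs ++ at xs t ∷ [] ≡ take (suc t) xs
take-snoc {zero}  (x ∷ xs) _         = refl
take-snoc {suc t} (x ∷ xs) (s≤s t<) = cong (x ∷_) (take-snoc xs t<)

drop-at : ∀ {r} (xs : List Bool) → r < length xs → drop r xs ≡ at xs r ∷ drop (suc r) xs
drop-at {zero}  (x ∷ xs) _         = refl
drop-at {suc r} (x ∷ xs) (s≤s r<) = drop-at xs r<

at-drop : ∀ k (xs : List Bool) i → at (drop k xs) i ≡ at xs (k ℕ.+ i)
at-drop zero    xs       i = refl
at-drop (suc k) []       i = refl
at-drop (suc k) (x ∷ xs) i = at-drop k xs i

isPrefixOf-take : ∀ j (xs : List Bool) → isPrefixOf (take j xs) xs ≡ true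
isPrefixOf-take zero    xs       = refl
isPrefixOf-take (suc j) []       = refl
isPrefixOf-take (suc j) (x ∷ xs) rewrite ==ᵇ-refl x = isPrefixOf-take j xs

isPrefixOf-snoc : ∀ (u v : List Bool) c → length u < length v →
  isPrefixOf (u ++ c ∷ []) v ≡ isPrefixOf u v ∧ (c ==ᵇ at v (length u))
isPrefixOf-snoc []      (y ∷ v) c _ with c ==ᵇ y
... | true  = refl
... | false = refl
isPrefixOf-snoc (x ∷ u) (y ∷ v) c (s≤s u<v) with x ==ᵇ y
... | true  = isPrefixOf-snoc u v c u<v
... | false = refl

isPrefixOf⇒take : ∀ (u v : List Bool) → isPrefixOf u v ≡ true → take (length u) v ≡ u
isPrefixOf⇒take []          v           _  = refl
isPrefixOf⇒take (true ∷ u)  (true ∷ v)  pre = cong (true ∷_) (isPrefixOf⇒take u v pre)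
isPrefixOf⇒take (false ∷ u) (false ∷ v) pre = cong (false ∷_) (isPrefixOf⇒take u v pre)

isPrefixOf⇒at : ∀ (u v : List Bool) → isPrefixOf u v ≡ true → ∀ i → i < length u → at u i ≡ at v i
isPrefixOf⇒at u v pre i i< = begin
    at u i                    ≡⟨ cong (λ w → at w i) (isPrefixOf⇒take u v pre) ⟨
    at (take (length u) v) i  ≡⟨ at-take (length u) v i< ⟩
    at v i                    ∎
  where
  open ≡-Reasoning
  at-take : ∀ n (xs : List Bool) {i} → i < n → at (take n xs) i ≡ at xs i
  at-take (suc n) []       _          = refl
  at-take (suc n) (x ∷ xs) {zero}  _         = refl
  at-take (suc n) (x ∷ xs) {suc i} (s≤s i<) = at-take n xs i<

at⇒isPrefixOf : ∀ (u v : List Bool) → length u ≤ length v →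
  (∀ i → i < length u → at u i ≡ at v i) → isPrefixOf u v ≡ true
at⇒isPrefixOf []      v       _          _    = refl
at⇒isPrefixOf (x ∷ u) (y ∷ v) (s≤s u≤v) same rewrite sym (same 0 (s≤s z≤n)) | ==ᵇ-refl x =
  at⇒isPrefixOf u v u≤v (λ i i< → same (suc i) (s≤s i<))

module _ (p : List Bool) where

  longestSP-≤ : ∀ x → longestSP p x ≤ length x
  longestSP-≤ []       = z≤n
  longestSP-≤ (c ∷ xs) with isPrefixOf (c ∷ xs) p
  ... | true  = ℕ.≤-refl
  ... | false = ℕ.m≤n⇒m≤1+n (longestSP-≤ xs)

  longestSP-full : ∀ x → longestSP p x ≡ length x → isPrefixOf x p ≡ true
  longestSP-full []       _ = refl
  longestSP-full (c ∷ xs) full with isPrefixOf (c ∷ xs) p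
  ... | true  = refl
  ... | false = ⊥-elim (ℕ.<-irrefl refl (subst (_≤ length xs) full (longestSP-≤ xs)))

  longestSP-prefix : ∀ x → isPrefixOf x p ≡ true → longestSP p x ≡ length x
  longestSP-prefix []       _   = refl
  longestSP-prefix (c ∷ xs) pre rewrite pre = refl

module KMP (p : List Bool) where

  m : ℕ
  m = length p

  -- kmpδ and transMatrix, with states and matrix indices taken in ℕ.
  next : ℕ → Bool → Target
  next s c = if (suc s ≡ᵇ m) ∧ (c ==ᵇ at p s) then accept else state (longestSP p (take s p ++ c ∷ []))

  transition : ℤMatrix
  transition r c = signBit false * hits (next c false) r + signBit true * hits (next c true) r

  -- λI − T_p is the pencil charA + λ charB.
  charA : ℤMatrix
  charA r c = - transition r c

  charB : ℤMatrix
  charB r c = if r ≡ᵇ c then 1ℤ else 0ℤ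

  failure : ℕ → ℕ
  failure k = longestSP p (take k p ++ not (at p k) ∷ [])

  longestSP-snoc-≤ : ∀ s c → longestSP p (take s p ++ c ∷ []) ≤ suc s
  longestSP-snoc-≤ s c = ℕ.≤-trans (longestSP-≤ p (take s p ++ c ∷ []))
    (subst (_≤ suc s) (sym (length-snoc (take s p) c)) (s≤s (length-take-≤ s p)))

  hits-next-far : ∀ s c r → suc s < r → hits (next s c) r ≡ 0ℤ
  hits-next-far s c r s+1<r with (suc s ≡ᵇ m) ∧ (c ==ᵇ at p s)
  ... | true  = refl
  ... | false rewrite dec-false (longestSP p (take s p ++ c ∷ []) ℕ.≟ r)
                (λ eq → ℕ.<-irrefl eq (ℕ.≤-<-trans (longestSP-snoc-≤ s c) s+1<r)) = refl

  charA-hessenberg : IsHessenberg charA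
  charA-hessenberg r c
    rewrite hits-next-far c false (suc (suc (c ℕ.+ r))) (s≤s (s≤s (ℕ.m≤m+n c r)))
          | hits-next-far c true  (suc (suc (c ℕ.+ r))) (s≤s (s≤s (ℕ.m≤m+n c r))) = refl

  charB-hessenberg : IsHessenberg charB
  charB-hessenberg r c rewrite dec-false (suc (suc (c ℕ.+ r)) ℕ.≟ c)
    (λ eq → ℕ.<-irrefl (sym eq) (s≤s (ℕ.m≤n⇒m≤1+n (ℕ.m≤m+n c r)))) = refl

  charB-subdiagonal : ∀ t → subdiagonal charB t ≡ 0ℤ
  charB-subdiagonal t rewrite dec-false (suc t ℕ.≟ t) (ℕ.1+n≢n) = refl

  length-prefix : ∀ {k} → k ≤ m → length (take k p) ≡ k
  length-prefix = length-take-of-≤ p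

  isPrefixOf-mismatch : ∀ k → k < m → isPrefixOf (take k p ++ not (at p k) ∷ []) p ≡ false
  isPrefixOf-mismatch k k<m = begin
      isPrefixOf (take k p ++ not (at p k) ∷ []) p
    ≡⟨ isPrefixOf-snoc (take k p) p (not (at p k)) (subst (_< m) (sym |w|) k<m) ⟩
      isPrefixOf (take k p) p ∧ (not (at p k) ==ᵇ at p (length (take k p)))
    ≡⟨ cong₂ (λ x n → x ∧ (not (at p k) ==ᵇ at p n)) (isPrefixOf-take k p) |w| ⟩
      (not (at p k) ==ᵇ at p k)
    ≡⟨ not-==ᵇ (at p k) ⟩
      false
    ∎
    where
    open ≡-Reasoning
    |w| = length-prefix (ℕ.<⇒≤ k<m)

  failure-≤ : ∀ k → k < m → failure k ≤ k
  failure-≤ k k<m = ℕ.≤-pred (ℕ.≤∧≢⇒< (longestSP-snoc-≤ k (not (at p k))) full⇒prefix)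
    where
    u = take k p ++ not (at p k) ∷ []
    full⇒prefix : failure k ≢ suc k
    full⇒prefix eq = false≢true (trans (sym (isPrefixOf-mismatch k k<m)) (longestSP-full p u
      (trans eq (sym (trans (length-snoc (take k p) _) (cong suc (length-prefix (ℕ.<⇒≤ k<m))))))))

  next-mismatch : ∀ k → next k (not (at p k)) ≡ state (failure k)
  next-mismatch k rewrite not-==ᵇ (at p k) with suc k ≡ᵇ m
  ... | true  = refl
  ... | false = refl

  hits-next-match : ∀ k r → k < m → r ≤ k → hits (next k (at p k)) r ≡ 0ℤ
  hits-next-match k r k<m r≤k rewrite ==ᵇ-refl (at p k) with suc k ≡ᵇ m
  ... | true  = refl
  ... | false rewrite take-snoc p k<m | longestSP-prefix p (take (suc k) p) (isPrefixOf-take (suc k) p)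
                    | length-prefix k<m
                    | dec-false (suc k ℕ.≟ r) (λ eq → ℕ.<-irrefl (sym eq) (s≤s r≤k)) = refl

  hits-subdiagonal-match : ∀ t → suc t < m → hits (next t (at p t)) (suc t) ≡ 1ℤ
  hits-subdiagonal-match t t+1<m
    rewrite ==ᵇ-refl (at p t) | dec-false (suc t ℕ.≟ m) (λ eq → ℕ.<-irrefl eq t+1<m)
          | take-snoc p (ℕ.<-trans (ℕ.n<1+n t) t+1<m)
          | longestSP-prefix p (take (suc t) p) (isPrefixOf-take (suc t) p)
          | length-prefix (ℕ.<⇒≤ t+1<m) | dec-true (suc t ℕ.≟ suc t) refl = refl

  hits-subdiagonal-mismatch : ∀ t → suc t < m → hits (next t (not (at p t))) (suc t) ≡ 0ℤ
  hits-subdiagonal-mismatch t t+1<m rewrite next-mismatch t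
    | dec-false (failure t ℕ.≟ suc t)
        (λ eq → ℕ.<-irrefl eq (s≤s (failure-≤ t (ℕ.<-trans (ℕ.n<1+n t) t+1<m)))) = refl

  transition-split : ∀ r c a → transition r c ≡
    signBit a * hits (next c a) r + signBit (not a) * hits (next c (not a)) r
  transition-split r c true  =
    ℤ.+-comm (signBit false * hits (next c false) r) (signBit true * hits (next c true) r)
  transition-split r c false = refl

  transition-column : ∀ k r → k < m → r ≤ k →
    transition r k ≡ signBit (not (at p k)) * hits (state (failure k)) r
  transition-column k r k<m r≤k = begin
      transition r k
    ≡⟨ transition-split r k a ⟩
      signBit a * hits (next k a) r + signBit (not a) * hits (next k (not a)) r
    ≡⟨ cong₂ (λ x y → signBit a * x + signBit (not a) * hits y r)
         (hits-next-match k r k<m r≤k) (next-mismatch k) ⟩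
      signBit a * 0ℤ + signBit (not a) * hits (state (failure k)) r
    ≡⟨ cong (_+ signBit (not a) * hits (state (failure k)) r) (ℤ.*-zeroʳ (signBit a)) ⟩
      0ℤ + signBit (not a) * hits (state (failure k)) r
    ≡⟨ ℤ.+-identityˡ _ ⟩
      signBit (not a) * hits (state (failure k)) r
    ∎
    where
    open ≡-Reasoning
    a = at p k

  transition-subdiagonal : ∀ t → suc t < m → transition (suc t) t ≡ signBit (at p t)
  transition-subdiagonal t t+1<m = begin
      transition (suc t) t
    ≡⟨ transition-split (suc t) t a ⟩
      signBit a * hits (next t a) (suc t) + signBit (not a) * hits (next t (not a)) (suc t)
    ≡⟨ cong₂ (λ x y → signBit a * x + signBit (not a) * y)
         (hits-subdiagonal-match t t+1<m) (hits-subdiagonal-mismatch t t+1<m) ⟩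
      signBit a * 1ℤ + signBit (not a) * 0ℤ
    ≡⟨ cong₂ _+_ (ℤ.*-identityʳ (signBit a)) (ℤ.*-zeroʳ (signBit (not a))) ⟩
      signBit a + 0ℤ
    ≡⟨ ℤ.+-identityʳ (signBit a) ⟩
      signBit a
    ∎
    where
    open ≡-Reasoning
    a = at p t

  negProdFrom-charA : ∀ r d → r ℕ.+ d < m → negProdFrom (subdiagonal charA) r d ≡ signOf (take d (drop r p))
  negProdFrom-charA r zero    _       = refl
  negProdFrom-charA r (suc d) r+d+1<m
    rewrite drop-at p (ℕ.≤-trans (s≤s (ℕ.m≤m+n r (suc d))) r+d+1<m) =
    cong₂ _*_ (trans (ℤ.neg-involutive (transition (suc r) r)) (transition-subdiagonal r r+1<m))
              (negProdFrom-charA (suc r) d (subst (_< m) (ℕ.+-suc r d) r+d+1<m))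
    where
    r+1<m : suc r < m
    r+1<m = ℕ.≤-trans (s≤s (s≤s (ℕ.m≤m+n r d))) (subst (_< m) (ℕ.+-suc r d) r+d+1<m)

  charDet : ℕ → Coeffs
  charDet k = pencilDet k charA charB

  charDet-recurrence : ∀ k → k < m → charDet (suc k) ≗ λ n →
    mulX (charDet k) n - signBit (not (at p k)) *
      (negProdFrom (subdiagonal charA) (failure k) (k ∸ failure k) * charDet (failure k) n)
  charDet-recurrence k k<m n = begin
      charDet (suc k) n
    ≡⟨ pencilDet-lastColumn k charA charB charA-hessenberg charB-hessenberg charB-subdiagonal n ⟩
      ∑[ r < suc k ] lastColumnTerm charA charB k (toℕ r) n
    ≡⟨ sum-cong-≗ {suc k} (λ r → split (toℕ r)) ⟩
      ∑[ r < suc k ] (fromA (toℕ r) + fromB (toℕ r))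
    ≡⟨ ∑-distrib-+ {suc k} (fromA ∘ toℕ) (fromB ∘ toℕ) ⟩
      ∑[ r < suc k ] fromA (toℕ r) + ∑[ r < suc k ] fromB (toℕ r)
    ≡⟨ cong₂ _+_ (sum-delta fromA f (s≤s f≤k) fromA-vanishes) (sum-delta fromB k ℕ.≤-refl fromB-vanishes) ⟩
      fromA f + fromB k
    ≡⟨ cong₂ _+_ fromA-failure fromB-diagonal ⟩
      - (sb * (N f * charDet f n)) + mulX (charDet k) n
    ≡⟨ ℤ.+-comm (- (sb * (N f * charDet f n))) (mulX (charDet k) n) ⟩
      mulX (charDet k) n - sb * (N f * charDet f n)
    ∎
    where
    open ≡-Reasoning
    f = failure k
    f≤k = failure-≤ k k<m
    sb = signBit (not (at p k))
    N : ℕ → ℤ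
    N r = negProdFrom (subdiagonal charA) r (k ∸ r)
    fromA fromB : ℕ → ℤ
    fromA r = N r * (charA r k * charDet r n)
    fromB r = N r * (charB r k * mulX (charDet r) n)
    split : ∀ r → lastColumnTerm charA charB k r n ≡ fromA r + fromB r
    split r = trans (cong (N r *_) (linearMul-expand (charA r k) (charB r k) (charDet r) n))
                    (ℤ.*-distribˡ-+ (N r) _ _)
    fromA-vanishes : ∀ (r : Fin (suc k)) → toℕ r ≢ f → fromA (toℕ r) ≡ 0ℤ
    fromA-vanishes r r≢f
      rewrite transition-column k (toℕ r) k<m (ℕ.≤-pred (toℕ<n r))
            | dec-false (f ℕ.≟ toℕ r) (r≢f ∘ sym) = vanish (N (toℕ r)) sb (charDet (toℕ r) n)
      where vanish : ∀ a b c → a * (- (b * 0ℤ) * c) ≡ 0ℤ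
            vanish = solve-∀
    fromB-vanishes : ∀ (r : Fin (suc k)) → toℕ r ≢ k → fromB (toℕ r) ≡ 0ℤ
    fromB-vanishes r r≢k rewrite dec-false (toℕ r ℕ.≟ k) r≢k =
      trans (cong (N (toℕ r) *_) (ℤ.*-zeroˡ (mulX (charDet (toℕ r)) n))) (ℤ.*-zeroʳ (N (toℕ r)))
    fromA-failure : fromA f ≡ - (sb * (N f * charDet f n))
    fromA-failure rewrite transition-column k f k<m f≤k | dec-true (f ℕ.≟ f) refl =
      rearrange (N f) sb (charDet f n)
      where rearrange : ∀ a b c → a * (- (b * 1ℤ) * c) ≡ - (b * (a * c))
            rearrange = solve-∀
    fromB-diagonal : fromB k ≡ mulX (charDet k) n
    fromB-diagonal rewrite ℕ.n∸n≡0 k | dec-true (k ℕ.≟ k) refl =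
      trans (ℤ.*-identityˡ _) (ℤ.*-identityˡ (mulX (charDet k) n))

  suffixIsPrefix : List Bool → ℕ → Bool
  suffixIsPrefix []       n = n ≡ᵇ 0
  suffixIsPrefix (c ∷ xs) n = if n ≡ᵇ length (c ∷ xs) then isPrefixOf (c ∷ xs) p else suffixIsPrefix xs n

  suffixIsPrefix-zero : ∀ x → suffixIsPrefix x 0 ≡ true
  suffixIsPrefix-zero []       = refl
  suffixIsPrefix-zero (c ∷ xs) = suffixIsPrefix-zero xs

  suffixIsPrefix-long : ∀ x n → length x < n → suffixIsPrefix x n ≡ false
  suffixIsPrefix-long []       (suc n) _ = refl
  suffixIsPrefix-long (c ∷ xs) n |x|<n
    rewrite dec-false (n ℕ.≟ length (c ∷ xs)) (λ eq → ℕ.<-irrefl (sym eq) |x|<n) =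
    suffixIsPrefix-long xs n (ℕ.<-trans (ℕ.n<1+n (length xs)) |x|<n)

  suffixIsPrefix-drop : ∀ y n → n ≤ length y → suffixIsPrefix y n ≡ isPrefixOf (drop (length y ∸ n) y) p
  suffixIsPrefix-drop []       zero    _ = refl
  suffixIsPrefix-drop (c ∷ xs) n n≤ with n ℕ.≟ suc (length xs)
  ... | yes refl rewrite dec-true (n ℕ.≟ n) refl | ℕ.n∸n≡0 (length xs) = refl
  ... | no n≢ with ℕ.≤-pred (ℕ.≤∧≢⇒< n≤ n≢)
  ...   | n≤xs rewrite dec-false (n ℕ.≟ suc (length xs)) n≢ | ℕ.+-∸-assoc 1 n≤xs =
    suffixIsPrefix-drop xs n n≤xs

  suffixIsPrefix-snoc : ∀ x c n → n < m →
    suffixIsPrefix (x ++ c ∷ []) (suc n) ≡ suffixIsPrefix x n ∧ (c ==ᵇ at p n)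
  suffixIsPrefix-snoc []      c zero    n<m = isPrefixOf-snoc [] p c n<m
  suffixIsPrefix-snoc []      c (suc n) _   = refl
  suffixIsPrefix-snoc (d ∷ x) c n n<m rewrite length-snoc x c with n ℕ.≟ suc (length x)
  ... | yes refl rewrite dec-true (n ℕ.≟ n) refl = isPrefixOf-snoc (d ∷ x) p c n<m
  ... | no n≢ rewrite dec-false (n ℕ.≟ suc (length x)) n≢ = suffixIsPrefix-snoc x c n n<m

  suffixIsPrefix-longestSP : ∀ x n → suffixIsPrefix x n ≡ suffixIsPrefix (take (longestSP p x) p) n
  suffixIsPrefix-longestSP []      n = refl
  suffixIsPrefix-longestSP (c ∷ x) n with isPrefixOf (c ∷ x) p in pre
  ... | true rewrite isPrefixOf⇒take (c ∷ x) p pre | pre = refl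
  ... | false with n ℕ.≟ suc (length x)
  ...   | yes refl rewrite dec-true (n ℕ.≟ n) refl =
          sym (trans (sym (suffixIsPrefix-longestSP x n)) (suffixIsPrefix-long x n ℕ.≤-refl))
  ...   | no n≢ rewrite dec-false (n ℕ.≟ suc (length x)) n≢ = suffixIsPrefix-longestSP x n

  signOf-border : ∀ y n → suffixIsPrefix y n ≡ true →
    signOf y ≡ signOf (take (length y ∸ n) y) * signOf (take n p)
  signOf-border y n border = begin
      signOf y
    ≡⟨ cong signOf (List.take++drop≡id (length y ∸ n) y) ⟨
      signOf (take (length y ∸ n) y ++ suffix)
    ≡⟨ signOf-++ (take (length y ∸ n) y) suffix ⟩
      signOf (take (length y ∸ n) y) * signOf suffix
    ≡⟨ cong (λ s → signOf (take (length y ∸ n) y) * signOf s) suffix≡ ⟩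
      signOf (take (length y ∸ n) y) * signOf (take n p)
    ∎
    where
    open ≡-Reasoning
    n≤y : n ≤ length y
    n≤y = ℕ.≮⇒≥ (λ y<n → ⊥-elim (false≢true (trans (sym (suffixIsPrefix-long y n y<n)) border)))
    suffix = drop (length y ∸ n) y
    suffix≡ : suffix ≡ take n p
    suffix≡ = begin
        suffix
      ≡⟨ isPrefixOf⇒take suffix p (trans (sym (suffixIsPrefix-drop y n n≤y)) border) ⟨
        take (length suffix) p
      ≡⟨ cong (λ k → take k p) (trans (List.length-drop (length y ∸ n) y) (ℕ.m∸[m∸n]≡n n≤y)) ⟩
        take n p
      ∎

  borderPoly : ℕ → Coeffs
  borderPoly k n = if suffixIsPrefix (take k p) n then signOf (take (k ∸ n) p) else 0ℤ

  borderPoly-above : ∀ k n → k < n → borderPoly k n ≡ 0ℤ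
  borderPoly-above k n k<n
    rewrite suffixIsPrefix-long (take k p) n (ℕ.≤-<-trans (length-take-≤ k p) k<n) = refl

  module BorderRecurrence (k : ℕ) (k<m : k < m) where

    a : Bool
    a = at p k

    f : ℕ
    f = failure k

    f≤k : f ≤ k
    f≤k = failure-≤ k k<m

    w : List Bool
    w = take k p

    |w| : length w ≡ k
    |w| = length-prefix (ℕ.<⇒≤ k<m)

    sb G : ℤ
    sb = signBit (not a)
    G  = signOf (take (k ∸ f) (drop f p))

    signOf-w : signOf w ≡ signOf (take f p) * G
    signOf-w = trans (cong signOf (take-split p f≤k)) (signOf-++ (take f p) _)

    border-match : ∀ n → n < m →
      suffixIsPrefix (take (suc k) p) (suc n) ≡ suffixIsPrefix w n ∧ (a ==ᵇ at p n)
    border-match n n<m =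
      trans (cong (λ x → suffixIsPrefix x (suc n)) (sym (take-snoc p k<m))) (suffixIsPrefix-snoc w a n n<m)

    border-mismatch : ∀ n → n < m →
      suffixIsPrefix (take f p) (suc n) ≡ suffixIsPrefix w n ∧ (not a ==ᵇ at p n)
    border-mismatch n n<m =
      trans (sym (suffixIsPrefix-longestSP (w ++ not a ∷ []) (suc n))) (suffixIsPrefix-snoc w (not a) n n<m)

    -- Both w ++ [¬a] and take f p end with the border take (suc n) p, whose sign squares to 1.
    mismatch-sign : ∀ n → n ≤ k → suffixIsPrefix w n ∧ (not a ==ᵇ at p n) ≡ true →
      signOf (take (k ∸ n) p) ≡ sb * (G * signOf (take (f ∸ suc n) p))
    mismatch-sign n n≤k border = begin
        S
      ≡⟨ sym (trans (cong (S *_) (signOf-square (take (suc n) p))) (ℤ.*-identityʳ S)) ⟩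
        S * (P * P)
      ≡⟨ sym (ℤ.*-assoc S P P) ⟩
        (S * P) * P
      ≡⟨ cong (_* P) (sym (trans (sym (signOf-++ w (not a ∷ []))) border-wb)) ⟩
        (signOf w * (sb * 1ℤ)) * P
      ≡⟨ cong (λ x → (x * (sb * 1ℤ)) * P) (trans signOf-w (cong (_* G) border-f)) ⟩
        ((T * P) * G * (sb * 1ℤ)) * P
      ≡⟨ rearrange T P G sb ⟩
        sb * (G * T) * (P * P)
      ≡⟨ trans (cong (sb * (G * T) *_) (signOf-square (take (suc n) p))) (ℤ.*-identityʳ _) ⟩
        sb * (G * T)
      ∎
      where
      open ≡-Reasoning
      S = signOf (take (k ∸ n) p)
      P = signOf (take (suc n) p)
      T = signOf (take (f ∸ suc n) p)
      n<m = ℕ.≤-<-trans n≤k k<m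
      k∸n≤k = ℕ.m∸n≤m k n
      border-wb : signOf (w ++ not a ∷ []) ≡ S * P
      border-wb = begin
          signOf (w ++ not a ∷ [])
        ≡⟨ signOf-border (w ++ not a ∷ []) (suc n) (trans (suffixIsPrefix-snoc w (not a) n n<m) border) ⟩
          signOf (take (length (w ++ not a ∷ []) ∸ suc n) (w ++ not a ∷ [])) * P
        ≡⟨ cong (λ l → signOf (take (l ∸ suc n) (w ++ not a ∷ [])) * P)
             (trans (length-snoc w (not a)) (cong suc |w|)) ⟩
          signOf (take (k ∸ n) (w ++ not a ∷ [])) * P
        ≡⟨ cong (λ x → signOf x * P) (trans (take-++-≤ w (not a ∷ []) (subst (k ∸ n ≤_) (sym |w|) k∸n≤k))
                                             (take-take-≤ p k∸n≤k)) ⟩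
          S * P
        ∎
      border-f : signOf (take f p) ≡ T * P
      border-f = begin
          signOf (take f p)
        ≡⟨ signOf-border (take f p) (suc n) (trans (border-mismatch n n<m) border) ⟩
          signOf (take (length (take f p) ∸ suc n) (take f p)) * P
        ≡⟨ cong (λ l → signOf (take (l ∸ suc n) (take f p)) * P) (length-prefix f≤m) ⟩
          signOf (take (f ∸ suc n) (take f p)) * P
        ≡⟨ cong (λ x → signOf x * P) (take-take-≤ p (ℕ.m∸n≤m f (suc n))) ⟩
          T * P
        ∎
        where f≤m = ℕ.≤-trans f≤k (ℕ.<⇒≤ k<m)
      rearrange : ∀ t q g s → ((t * q) * g * (s * 1ℤ)) * q ≡ s * (g * t) * (q * q)
      rearrange = solve-∀

    private
      vanish : ∀ s g → 0ℤ ≡ 0ℤ - s * (g * 0ℤ)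
      vanish = solve-∀

    recurrence : ∀ n → borderPoly (suc k) n ≡ mulX (borderPoly k) n - sb * (G * borderPoly f n)
    recurrence zero rewrite suffixIsPrefix-zero (take (suc k) p) | suffixIsPrefix-zero (take f p) = begin
        signOf (take (suc k) p)
      ≡⟨ cong signOf (take-snoc p k<m) ⟨
        signOf (w ++ a ∷ [])
      ≡⟨ signOf-++ w (a ∷ []) ⟩
        signOf w * (signBit a * 1ℤ)
      ≡⟨ cong₂ (λ x y → x * (y * 1ℤ)) signOf-w (signBit-flip a) ⟩
        (signOf (take f p) * G) * (- sb * 1ℤ)
      ≡⟨ rearrange (signOf (take f p)) G sb ⟩
        0ℤ - sb * (G * signOf (take f p))
      ∎
      where
      open ≡-Reasoning
      rearrange : ∀ t g s → (t * g) * (- s * 1ℤ) ≡ 0ℤ - s * (g * t)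
      rearrange = solve-∀
    recurrence (suc n) with n ℕ.≤? k
    ... | no n≰k rewrite borderPoly-above (suc k) (suc n) (s≤s (ℕ.≰⇒> n≰k))
                       | borderPoly-above k n (ℕ.≰⇒> n≰k)
                       | borderPoly-above f (suc n) (s≤s (ℕ.≤-trans f≤k (ℕ.<⇒≤ (ℕ.≰⇒> n≰k)))) =
      vanish sb G
    ... | yes n≤k rewrite border-match n (ℕ.≤-<-trans n≤k k<m) | border-mismatch n (ℕ.≤-<-trans n≤k k<m)
      with suffixIsPrefix w n in border | ==ᵇ-not-either a (at p n)
    ...   | false | _ = vanish sb G
    ...   | true | inj₁ (match , mismatch) rewrite match | mismatch = unaffected _ sb G
      where unaffected : ∀ x s g → x ≡ x - s * (g * 0ℤ)
            unaffected = solve-∀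
    ...   | true | inj₂ (match , mismatch) rewrite match | mismatch =
      trans (sym (ℤ.+-inverseʳ S)) (cong (λ x → S - x) (mismatch-sign n n≤k (cong₂ _∧_ border mismatch)))
      where S = signOf (take (k ∸ n) p)

  charDet≗borderPoly : ∀ k → k ≤ m → charDet k ≗ borderPoly k
  charDet≗borderPoly = <-rec (λ k → k ≤ m → charDet k ≗ borderPoly k) induct
    where
    induct : ∀ k → (∀ {j} → j < k → j ≤ m → charDet j ≗ borderPoly j) → k ≤ m → charDet k ≗ borderPoly k
    induct zero    _  _ zero    = refl
    induct zero    _  _ (suc n) = refl
    induct (suc k) IH k<m n = begin
        charDet (suc k) n
      ≡⟨ charDet-recurrence k k<m n ⟩
        mulX (charDet k) n - sb * (negProdFrom (subdiagonal charA) f (k ∸ f) * charDet f n)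
      ≡⟨ cong₂ (λ x y → x - sb * y)
           (mulX-cong (IH ℕ.≤-refl (ℕ.<⇒≤ k<m)) n)
           (cong₂ _*_ (negProdFrom-charA f (k ∸ f) (subst (_< m) (sym (ℕ.m+[n∸m]≡n f≤k)) k<m))
                      (IH (s≤s f≤k) (ℕ.≤-trans f≤k (ℕ.<⇒≤ k<m)) n)) ⟩
        mulX (borderPoly k) n - sb * (G * borderPoly f n)
      ≡⟨ recurrence n ⟨
        borderPoly (suc k) n
      ∎
      where
      open ≡-Reasoning
      open BorderRecurrence k k<m

  borderPoly-complement : ∀ k → k ≤ m →
    borderPoly m (m ∸ k) ≡ (if isPrefixOf (drop k p) p then signOf (take k p) else 0ℤ)
  borderPoly-complement k k≤m
    rewrite List.take-all m p ℕ.≤-refl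
          | suffixIsPrefix-drop p (m ∸ k) (ℕ.m∸n≤m m k)
          | ℕ.m∸[m∸n]≡n k≤m = refl

lookup≡at : ∀ {m} (p : Vec Bool m) i → lookup p i ≡ at (toList p) (toℕ i)
lookup≡at (x Vec.∷ p) fzero    = refl
lookup≡at (x Vec.∷ p) (fsuc i) = lookup≡at p i

module _ {m} (p : Vec Bool m) where

  open KMP (toList p) using (next; transition; charA; charB; charDet)

  kmpδ≡next : ∀ s c → kmpδ p s c ≡ next (toℕ s) c
  kmpδ≡next s c = cong₂ (λ l x → if (suc (toℕ s) ≡ᵇ l) ∧ (c ==ᵇ x) then accept
                                  else state (longestSP (toList p) (take (toℕ s) (toList p) ++ c ∷ [])))
                        (sym (Vec.length-toList p)) (lookup≡at p s)

  transMatrix≡transition : ∀ j i → transMatrix p j i ≡ transition (toℕ j) (toℕ i)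
  transMatrix≡transition j i =
    cong₂ (λ x y → signBit false * hits x (toℕ j) + signBit true * hits y (toℕ j))
          (kmpδ≡next i false) (kmpδ≡next i true)

  charMatrix≈pencil : ∀ j i →
    (if δFin j i then X else []) +P negP (constP (transMatrix p j i)) ≈ pencil m charA charB j i
  charMatrix≈pencil j i n with toℕ j ≡ᵇ toℕ i
  charMatrix≈pencil j i zero          | true  =
    trans (ℤ.+-identityˡ _) (cong -_ (transMatrix≡transition j i))
  charMatrix≈pencil j i (suc zero)    | true  = refl
  charMatrix≈pencil j i (suc (suc n)) | true  = refl
  charMatrix≈pencil j i zero          | false = cong -_ (transMatrix≡transition j i)
  charMatrix≈pencil j i (suc zero)    | false = refl
  charMatrix≈pencil j i (suc (suc n)) | false = refl

  charPoly≗charDet : coeff (charPoly p) ≗ charDet m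
  charPoly≗charDet = det-cong m charMatrix≈pencil

module _ {m} (p : Vec Bool m) (k : ℕ) where

  private
    ps = toList p

    |drop| : length (drop k ps) ≡ m ∸ k
    |drop| = trans (List.length-drop k ps) (cong (_∸ k) (Vec.length-toList p))

    at≡lookup : ∀ {i} (i<m : i < m) → at ps i ≡ lookup p (fromℕ< i<m)
    at≡lookup i<m = trans (cong (at ps) (sym (toℕ-fromℕ< i<m))) (sym (lookup≡at p (fromℕ< i<m)))

  periodic⇒isPrefixOf-drop : k ≤ m → Periodic p k → isPrefixOf (drop k ps) ps ≡ true
  periodic⇒isPrefixOf-drop k≤m periodic = at⇒isPrefixOf (drop k ps) ps
    (ℕ.≤-trans (ℕ.≤-reflexive (List.length-drop k ps)) (ℕ.m∸n≤m _ k)) same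
    where
    same : ∀ i → i < length (drop k ps) → at (drop k ps) i ≡ at ps i
    same i i< = begin
        at (drop k ps) i                 ≡⟨ at-drop k ps i ⟩
        at ps (k ℕ.+ i)                  ≡⟨ cong (at ps) (ℕ.+-comm k i) ⟩
        at ps (i ℕ.+ k)                  ≡⟨ at≡lookup i+k<m ⟩
        lookup p (fromℕ< i+k<m)          ≡⟨ periodic (fromℕ< i<m) (fromℕ< i+k<m) toℕ-shift ⟨
        lookup p (fromℕ< i<m)            ≡⟨ at≡lookup i<m ⟨
        at ps i                          ∎
      where
      open ≡-Reasoning
      i+k<m : i ℕ.+ k < m
      i+k<m = ℕ.m≤o∸n⇒m+n≤o (suc i) k≤m (subst (i <_) |drop| i<)
      i<m : i < m
      i<m = ℕ.≤-<-trans (ℕ.m≤m+n i k) i+k<m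
      toℕ-shift : toℕ (fromℕ< i+k<m) ≡ toℕ (fromℕ< i<m) ℕ.+ k
      toℕ-shift = trans (toℕ-fromℕ< i+k<m) (cong (ℕ._+ k) (sym (toℕ-fromℕ< i<m)))

  isPrefixOf-drop⇒periodic : isPrefixOf (drop k ps) ps ≡ true → Periodic p k
  isPrefixOf-drop⇒periodic prefix i j j≡i+k = begin
      lookup p i                 ≡⟨ lookup≡at p i ⟩
      at ps (toℕ i)              ≡⟨ isPrefixOf⇒at (drop k ps) ps prefix (toℕ i) i<|drop| ⟨
      at (drop k ps) (toℕ i)     ≡⟨ at-drop k ps (toℕ i) ⟩
      at ps (k ℕ.+ toℕ i)        ≡⟨ cong (at ps) (trans (ℕ.+-comm k (toℕ i)) (sym j≡i+k)) ⟩
      at ps (toℕ j)              ≡⟨ lookup≡at p j ⟨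
      lookup p j                 ∎
    where
    open ≡-Reasoning
    i<|drop| : toℕ i < length (drop k ps)
    i<|drop| = subst (toℕ i <_) (sym |drop|)
      (ℕ.m+n≤o⇒m≤o∸n (suc (toℕ i)) (subst (_< m) j≡i+k (toℕ<n j)))

module _ {m} (p : Vec Bool m) where

  open KMP (toList p) using (borderPoly; charDet≗borderPoly; borderPoly-complement)

  private
    ps = toList p
    |ps| = Vec.length-toList p

  charPoly≗borderPoly : coeff (charPoly p) ≗ borderPoly m
  charPoly≗borderPoly n =
    trans (charPoly≗charDet p n) (charDet≗borderPoly m (ℕ.≤-reflexive (sym |ps|)) n)

  charPoly-coeff-complement : ∀ k → k ≤ m →
    coeff (charPoly p) (m ∸ k) ≡ (if isPrefixOf (drop k ps) ps then signOf (take k ps) else 0ℤ)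
  charPoly-coeff-complement k k≤m = begin
      coeff (charPoly p) (m ∸ k)             ≡⟨ charPoly≗borderPoly (m ∸ k) ⟩
      borderPoly m (m ∸ k)                   ≡⟨ cong (λ l → borderPoly l (l ∸ k)) (sym |ps|) ⟩
      borderPoly (length ps) (length ps ∸ k) ≡⟨ borderPoly-complement k (subst (k ≤_) (sym |ps|) k≤m) ⟩
      (if isPrefixOf (drop k ps) ps then signOf (take k ps) else 0ℤ) ∎
    where open ≡-Reasoning

theorem5 : (m : ℕ) (p : Vec Bool m) →
    (coeff (charPoly p) m ≡ 1ℤ)
    × ((n : ℕ) → m < n → coeff (charPoly p) n ≡ 0ℤ)
    × ((k : ℕ) → 1 ≤ k → k ≤ m →
        (Periodic p k → coeff (charPoly p) (m ∸ k) ≡ -1ℤ ^ℤ wt (take k (toList p)))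
        × (¬ Periodic p k → coeff (charPoly p) (m ∸ k) ≡ 0ℤ))
theorem5 m p = leading , vanishing , λ k _ k≤m → periodic k k≤m , aperiodic k k≤m
  where
  ps = toList p
  coefficient : ℕ → Bool → ℤ
  coefficient k b = if b then signOf (take k ps) else 0ℤ
  leading : coeff (charPoly p) m ≡ 1ℤ
  leading = trans (charPoly-coeff-complement p 0 z≤n)
    (cong (coefficient 0) (at⇒isPrefixOf ps ps ℕ.≤-refl (λ _ _ → refl)))
  vanishing : ∀ n → m < n → coeff (charPoly p) n ≡ 0ℤ
  vanishing n m<n = trans (charPoly≗borderPoly p n) (KMP.borderPoly-above ps m n m<n)
  periodic : ∀ k → k ≤ m → Periodic p k → coeff (charPoly p) (m ∸ k) ≡ -1ℤ ^ℤ wt (take k ps)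
  periodic k k≤m per = trans (charPoly-coeff-complement p k k≤m)
    (trans (cong (coefficient k) (periodic⇒isPrefixOf-drop p k k≤m per)) (signOf≡-1^wt (take k ps)))
  aperiodic : ∀ k → k ≤ m → ¬ Periodic p k → coeff (charPoly p) (m ∸ k) ≡ 0ℤ
  aperiodic k k≤m ¬per = trans (charPoly-coeff-complement p k k≤m)
    (cong (coefficient k) (¬-not (¬per ∘ isPrefixOf-drop⇒periodic p k)))
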